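{- Let $r$ be a power of an odd prime $p$, and let $q$ be a power of $r$. If $c\in\mathbb{F}_{q^2}\setminus\mathbb{F}_q$ satisfies $(c^{r-1}+1)^{(r+1)/2}/c^{r(r-1)/2}\in\mathbb{F}_q$, then $\operatorname{Tr}_{\mathbb{F}_{q^2}/\mathbb{F}_r}(c) = 0$. -}

module Defs where

open import Level using (Level)
open import Data.Nat as ℕ using (ℕ; zero; suc)
open import Data.Fin using (Fin)
open import Data.Product using (Σ; _×_)
open import Relation.Nullary using (¬_)
open import Relation.Binary.PropositionalEquality as ≡ using (_≡_)
open import Function.Bundles using (Inverse)
open import Algebra.Bundles using (CommutativeRing; Semiring)
import Algebra.Definitions.RawSemiring as RS

record IsFiniteFieldOfOrder {c ℓ : Level} (F : CommutativeRing c ℓ) (N : ℕ)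
       : Set (c Level.⊔ ℓ) where
  open CommutativeRing F
  field
    1≉0     : ¬ (1# ≈ 0#)
    inverse : ∀ x → ¬ (x ≈ 0#) → Σ Carrier (λ y → (x * y) ≈ 1#)
    count   : Inverse (≡.setoid (Fin N)) setoid

module _ {c ℓ : Level} (F : CommutativeRing c ℓ) where
  open CommutativeRing F
  open RS (Semiring.rawSemiring semiring) using (_^_)

  -- The subfield F_s of a field F (with F_s ⊆ F): the elements fixed by x ↦ x^s.
  InSubfield : ℕ → Carrier → Set ℓ
  InSubfield s x = (x ^ s) ≈ x

  -- Σ_{i < m} x^(r^i) : the trace Tr_{F_{r^m}/F_r}(x) of x in a field of
  -- order r^m.
  traceSum : (r m : ℕ) → Carrier → Carrier
  traceSum r zero    x = 0#
  traceSum r (suc m) x = traceSum r m x + (x ^ (r ℕ.^ m))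

  Tr : (r m : ℕ) → Carrier → Carrier
  Tr = traceSum

  pow : Carrier → ℕ → Carrier
  pow x n = x ^ n

  -- "a / b ∈ F_s" for b ≠ 0: b has an inverse y and a·y ∈ F_s
  -- (inverses in a field are unique, so this is the quotient a/b).
  QuotientInSubfield : ℕ → Carrier → Carrier → Set (c Level.⊔ ℓ)
  QuotientInSubfield s a b = Σ Carrier (λ y → ((b * y) ≈ 1#) × InSubfield s (a * y))

-- Write r for the power of p, q = r^m and y = x^q for the conjugate of x over F_q. The square
-- of the quotient A of the statement is ψ(x), where ψ(z) = (z^{r²} + z^r)(z^r + z)/(z·z^{r²}).
-- Since z ↦ z^q is a ring map commuting with z ↦ z^r and fixing A, also A² = ψ(y).
-- If D = y·x^r − x·y^r ≠ 0, equating the two expressions for A² shows that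
-- w = x·x^r·(y^r + y)/D satisfies w^r − w = x^r, so Tr x = Tr x^r = Tr (w^r − w) = 0.
-- If D = 0, then u = y/x is fixed by z ↦ z^r, hence u = u^q = x/y; so u² = 1, u ≠ 1 as x ∉ F_q,
-- and y = −x. Then Tr x = (Tr x)^q = Tr y = −Tr x, and Tr x = 0 as the characteristic is odd.
module Submission where

open import Defs
open import Level using (Level)
open import Data.Nat as ℕ using (ℕ; suc)
open import Data.Nat.Primality using (Prime)
open import Relation.Nullary using (¬_)
open import Relation.Binary.PropositionalEquality using (_≢_)
open import Algebra.Bundles using (CommutativeRing)

open import Data.Nat using (zero; _!)
import Data.Nat.Properties as ℕ
open import Data.Nat.Divisibility using (_∣_; _∤_; divides; m∣m*n; m%n≡0⇒n∣m; ∣1⇒≡1; ∣⇒≤)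
open import Data.Nat.DivMod using (m/n*n≡m; m*n/n≡m; m≡m%n+[m/n]*n; %-distribˡ-*; m%n<n)
open import Data.Nat.Primality using (¬prime[0]; ¬prime[1]; euclidsLemma; prime⇒irreducible)
open import Data.Nat.Combinatorics using (_C_; nCn≡1; k![n∸k]!∣n!)
open import Data.Nat.Combinatorics.Specification using (nCk≡n!/k![n-k]!)
open import Data.Integer as ℤ using (ℤ; 1ℤ; _⊖_; _◃_)
import Data.Integer.Properties as ℤ
open import Data.Sign as Sign using (Sign)
open import Data.Fin as Fin using (Fin; punchIn)
open import Data.Fin.Properties using (punchInᵢ≢i; toℕ-inject₁; toℕ<n; toℕ-fromℕ)
open import Data.Fin.Permutation as Perm using (Permutation; permutation; _⟨$⟩ʳ_)
open import Data.Maybe using (Maybe; just; nothing)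
open import Data.Product using (Σ; _,_; proj₁; proj₂)
open import Data.Sum using (inj₁; inj₂; [_,_]′)
open import Data.Empty using (⊥-elim)
open import Function using (_$_; _∘_; id)
open import Function.Bundles using (Inverse)
open import Relation.Nullary using (yes; no)
open import Relation.Nullary.Negation using (contradiction)
open import Relation.Binary.Definitions using (Decidable)
open import Relation.Binary.PropositionalEquality as ≡ using (_≡_)
open import Algebra.Bundles using (CommutativeMonoid)
open import Algebra.Solver.Ring.AlmostCommutativeRing
  using (fromCommutativeRing; _-Raw-AlmostCommutative⟶_)

prime∤! : ∀ {p m} → Prime p → m ℕ.< p → p ∤ m !
prime∤! {m = zero}  p-prime _   p∣1 = ¬prime[1] (≡.subst Prime (∣1⇒≡1 p∣1) p-prime)
prime∤! {m = suc m} p-prime m<p p∣m! with euclidsLemma (suc m) (m !) p-prime p∣m!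
... | inj₁ p∣1+m = ℕ.<⇒≱ m<p (∣⇒≤ p∣1+m)
... | inj₂ p∣m!  = prime∤! p-prime (ℕ.<-trans (ℕ.n<1+n m) m<p) p∣m!

prime∣pCk : ∀ {p k} → Prime p → 0 ℕ.< k → k ℕ.< p → p ∣ p C k
prime∣pCk {p} {k} p-prime 0<k k<p =
  [ id , ⊥-elim ∘ p∤k![p∸k]! ]′ (euclidsLemma (p C k) (k ! ℕ.* (p ℕ.∸ k) !) p-prime p∣pCk*k![p∸k]!)
  where
  k≤p = ℕ.<⇒≤ k<p
  n∣n! : ∀ {n} → 0 ℕ.< n → n ∣ n !
  n∣n! {suc n} _ = m∣m*n (n !)
  p∣pCk*k![p∸k]! : p ∣ (p C k) ℕ.* (k ! ℕ.* (p ℕ.∸ k) !)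
  p∣pCk*k![p∸k]! = ≡.subst (p ∣_)
    (≡.sym (≡.trans (≡.cong (ℕ._* (k ! ℕ.* (p ℕ.∸ k) !)) (nCk≡n!/k![n-k]! k≤p))
                    (m/n*n≡m {{_}} (k![n∸k]!∣n! k≤p))))
    (n∣n! (ℕ.<-trans 0<k k<p))
  p∤k![p∸k]! : p ∤ k ! ℕ.* (p ℕ.∸ k) !
  p∤k![p∸k]! p∣k![p∸k]! = [ prime∤! p-prime k<p , prime∤! p-prime (ℕ.∸-monoʳ-< 0<k k≤p) ]′
    (euclidsLemma (k !) ((p ℕ.∸ k) !) p-prime p∣k![p∸k]!)

odd-prime : ∀ {p} → Prime p → p ≢ 2 → p ℕ.% 2 ≡ 1
odd-prime {p} p-prime p≢2 with p ℕ.% 2 in p%2≡0 | m%n<n p 2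
... | 0           | _ = ⊥-elim $
  [ (λ ()) , p≢2 ∘ ≡.sym ]′ (prime⇒irreducible p-prime (m%n≡0⇒n∣m p 2 p%2≡0))
... | 1           | _ = ≡.refl
... | suc (suc _) | ℕ.s≤s (ℕ.s≤s ())

odd-^ : ∀ n → n ℕ.% 2 ≡ 1 → ∀ k → (n ℕ.^ k) ℕ.% 2 ≡ 1
odd-^ n n-odd zero    = ≡.refl
odd-^ n n-odd (suc k) = ≡.trans (%-distribˡ-* n (n ℕ.^ k) 2)
                                (≡.cong₂ (λ a b → (a ℕ.* b) ℕ.% 2) n-odd (odd-^ n n-odd k))

odd⇒≡1+[n/2]*2 : ∀ n → n ℕ.% 2 ≡ 1 → n ≡ suc (n ℕ./ 2 ℕ.* 2)
odd⇒≡1+[n/2]*2 n n-odd = ≡.trans (m≡m%n+[m/n]*n n 2) (≡.cong (ℕ._+ n ℕ./ 2 ℕ.* 2) n-odd)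

-- The ring solver over an arbitrary commutative ring. Coefficients taken from the ring itself
-- would not compute, so normal forms could not be compared by refl; integer ones do.
module IntegerCoefficients {c ℓ : Level} (R : CommutativeRing c ℓ) where
  open CommutativeRing R
  open import Data.Integer using (+_; -[1+_])
  open import Algebra.Properties.Ring ring
    using (-0#≈0#; -‿involutive; -‿distribˡ-*; -‿distribʳ-*; -‿+-comm)
  open import Algebra.Properties.CommutativeSemigroup +-commutativeSemigroup using (interchange)
  open import Algebra.Properties.Semiring.Mult.TCOptimised semiring
    using (_×_; ×1-homo-*; ×-homo-+; 1+×)
  open import Relation.Binary.Reasoning.Setoid setoid

  signed : Sign → Carrier → Carrier
  signed Sign.+ x = x
  signed Sign.- x = - x

  -- The optimised multiple makes fromℤ 1ℤ definitionally 1#, so con 1ℤ denotes 1#.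
  fromℤ : ℤ → Carrier
  fromℤ i = signed (ℤ.sign i) (ℤ.∣ i ∣ × 1#)

  signed-cong : ∀ s {x y} → x ≈ y → signed s x ≈ signed s y
  signed-cong Sign.+ x≈y = x≈y
  signed-cong Sign.- x≈y = -‿cong x≈y

  signed-* : ∀ s t x y → signed (s Sign.* t) (x * y) ≈ signed s x * signed t y
  signed-* Sign.+ Sign.+ x y = refl
  signed-* Sign.+ Sign.- x y = -‿distribʳ-* x y
  signed-* Sign.- Sign.+ x y = -‿distribˡ-* x y
  signed-* Sign.- Sign.- x y = begin
    x * y         ≈⟨ -‿involutive (x * y) ⟨
    - (- (x * y)) ≈⟨ -‿cong (-‿distribˡ-* x y) ⟩
    - (- x * y)   ≈⟨ -‿distribʳ-* (- x) y ⟩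
    - x * - y     ∎

  ◃-homo : ∀ s n → fromℤ (s ◃ n) ≈ signed s (n × 1#)
  ◃-homo Sign.+ zero    = refl
  ◃-homo Sign.- zero    = sym -0#≈0#
  ◃-homo Sign.+ (suc n) = refl
  ◃-homo Sign.- (suc n) = refl

  *-homo : ∀ i j → fromℤ (i ℤ.* j) ≈ fromℤ i * fromℤ j
  *-homo i j = begin
    fromℤ (i ℤ.* j)                           ≈⟨ ◃-homo (s Sign.* t) (∣i∣ ℕ.* ∣j∣) ⟩
    signed (s Sign.* t) ((∣i∣ ℕ.* ∣j∣) × 1#)  ≈⟨ signed-cong (s Sign.* t) (×1-homo-* ∣i∣ ∣j∣) ⟩
    signed (s Sign.* t) (∣i∣ × 1# * ∣j∣ × 1#) ≈⟨ signed-* s t _ _ ⟩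
    fromℤ i * fromℤ j                         ∎
    where
    s = ℤ.sign i
    t = ℤ.sign j
    ∣i∣ = ℤ.∣ i ∣
    ∣j∣ = ℤ.∣ j ∣

  -‿homo : ∀ i → fromℤ (ℤ.- i) ≈ - fromℤ i
  -‿homo (+ zero)  = sym -0#≈0#
  -‿homo (+ suc n) = refl
  -‿homo -[1+ n ]  = sym (-‿involutive _)

  ⊖-homo : ∀ m n → fromℤ (m ⊖ n) ≈ m × 1# - n × 1#
  ⊖-homo zero    zero    = sym (trans (+-congˡ -0#≈0#) (+-identityʳ 0#))
  ⊖-homo (suc m) zero    = sym (trans (+-congˡ -0#≈0#) (+-identityʳ _))
  ⊖-homo zero    (suc n) = sym (+-identityˡ _)
  ⊖-homo (suc m) (suc n) = begin
    fromℤ (suc m ⊖ suc n)    ≡⟨ ≡.cong fromℤ (ℤ.[1+m]⊖[1+n]≡m⊖n m n) ⟩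
    fromℤ (m ⊖ n)            ≈⟨ ⊖-homo m n ⟩
    a - b                    ≈⟨ +-identityˡ (a - b) ⟨
    0# + (a - b)             ≈⟨ +-congʳ (-‿inverseʳ 1#) ⟨
    (1# - 1#) + (a - b)      ≈⟨ interchange 1# a (- 1#) (- b) ⟨
    (1# + a) + (- 1# - b)    ≈⟨ +-cong (1+× m 1#) (sym (-‿+-comm 1# b)) ⟨
    suc m × 1# - (1# + b)    ≈⟨ +-congˡ (-‿cong (1+× n 1#)) ⟨
    suc m × 1# - suc n × 1#  ∎
    where
    a = m × 1#
    b = n × 1#

  +-homo : ∀ i j → fromℤ (i ℤ.+ j) ≈ fromℤ i + fromℤ j
  +-homo (+ m)    (+ n)    = ×-homo-+ 1# m n
  +-homo (+ m)    -[1+ n ] = ⊖-homo m (suc n)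
  +-homo -[1+ m ] (+ n)    = trans (⊖-homo n (suc m)) (+-comm _ _)
  +-homo -[1+ m ] -[1+ n ] = begin
    - (suc (suc m ℕ.+ n) × 1#)     ≡⟨ ≡.cong (λ k → - (k × 1#)) (ℕ.+-suc (suc m) n) ⟨
    - ((suc m ℕ.+ suc n) × 1#)     ≈⟨ -‿cong (×-homo-+ 1# (suc m) (suc n)) ⟩
    - (suc m × 1# + suc n × 1#)    ≈⟨ -‿+-comm _ _ ⟨
    - (suc m × 1#) - suc n × 1#    ∎

  morphism : ℤ.+-*-rawRing -Raw-AlmostCommutative⟶ fromCommutativeRing R
  morphism = record
    { ⟦_⟧ = fromℤ ; +-homo = +-homo ; *-homo = *-homo ; -‿homo = -‿homo
    ; 0-homo = refl ; 1-homo = refl }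

  fromℤ-equal? : ∀ i j → Maybe (fromℤ i ≈ fromℤ j)
  fromℤ-equal? i j with i ℤ.≟ j
  ... | yes i≡j = just (reflexive (≡.cong fromℤ i≡j))
  ... | no _    = nothing

  open import Algebra.Solver.Ring ℤ.+-*-rawRing (fromCommutativeRing R) morphism fromℤ-equal? public

module SumTranslation {a ℓ : Level} (M : CommutativeMonoid a ℓ) where
  open CommutativeMonoid M
  open import Algebra.Properties.CommutativeMonoid.Sum M
    using (sum; sum-replicate; ∑-distrib-+; sum-cong-≋; sum-permute)
  open import Algebra.Properties.Monoid.Mult monoid using (_×_)
  open import Relation.Binary.Reasoning.Setoid setoid

  sum-translate : ∀ {k} (t : Fin k → Carrier) (π : Permutation k k) x →
                  (∀ j → x ∙ t j ≈ t (π ⟨$⟩ʳ j)) → (k × x) ∙ sum t ≈ sum t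
  sum-translate {k} t π x x∙t≈t∘π = begin
    (k × x) ∙ sum t           ≈⟨ ∙-congʳ (sum-replicate k) ⟨
    sum {k} (λ _ → x) ∙ sum t ≈⟨ ∑-distrib-+ (λ _ → x) t ⟨
    sum (λ j → x ∙ t j)       ≈⟨ sum-cong-≋ {k} x∙t≈t∘π ⟩
    sum (λ j → t (π ⟨$⟩ʳ j))  ≈⟨ sum-permute t π ⟨
    sum t                     ∎

module PowerMaps {c ℓ : Level} (R : CommutativeRing c ℓ) where
  open CommutativeRing R
  open IntegerCoefficients R using (solve; _:+_; _:*_; _:-_; _:=_; con)
  open import Algebra.Properties.Ring ring
    using (x+x≈x⇒x≈0; +-inverseˡ-unique; -‿+-comm; -0#≈0#; +-cancelʳ; xyx⁻¹≈y; x≈y⇒x∙y⁻¹≈ε)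
  open import Algebra.Properties.CommutativeSemigroup +-commutativeSemigroup
    using (interchange; xy∙z≈xz∙y)
  open import Algebra.Properties.CommutativeSemigroup *-commutativeSemigroup
    using () renaming (xy∙z≈xz∙y to xy*z≈xz*y)
  open import Algebra.Properties.Semiring.Exp semiring using (_^_; ^-congˡ; ^-congʳ; ^-assocʳ)
  open import Algebra.Properties.CommutativeSemiring.Exp commutativeSemiring using (^-distrib-*)
  open import Algebra.Properties.Semiring.Mult semiring using (_×_; ×-assoc-*; ×1-homo-*)
  open import Algebra.Properties.Monoid.Mult +-monoid using (×-congʳ; ×-homo-1)
  open import Algebra.Properties.CommutativeSemiring.Binomial commutativeSemiring
    using (theorem; binomialExpansion; binomialTerm)
  open import Algebra.Properties.Semiring.Sum semiring
    using (sum; sum-init-last; sum-cong-≋; sum-replicate-zero)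
  open import Relation.Binary.Reasoning.Setoid setoid

  1^n≈1 : ∀ n → 1# ^ n ≈ 1#
  1^n≈1 zero    = refl
  1^n≈1 (suc n) = trans (*-identityˡ _) (1^n≈1 n)

  ^-comm : ∀ x m n → (x ^ m) ^ n ≈ (x ^ n) ^ m
  ^-comm x m n = trans (^-assocʳ x m n) (trans (^-congʳ x (ℕ.*-comm m n)) (sym (^-assocʳ x n m)))

  ^-fixed-^ : ∀ {x e} → x ^ e ≈ x → ∀ j → x ^ (e ℕ.^ j) ≈ x
  ^-fixed-^ x^e≈x zero = *-identityʳ _
  ^-fixed-^ {x} {e} x^e≈x (suc j) = begin
    x ^ (e ℕ.* e ℕ.^ j) ≈⟨ ^-assocʳ x e (e ℕ.^ j) ⟨
    (x ^ e) ^ (e ℕ.^ j) ≈⟨ ^-congˡ (e ℕ.^ j) x^e≈x ⟩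
    x ^ (e ℕ.^ j)       ≈⟨ ^-fixed-^ x^e≈x j ⟩
    x                   ∎

  ^-fixes-quotient : ∀ e {x y ι} → x * ι ≈ 1# → y * x ^ e ≈ x * y ^ e → (y * ι) ^ e ≈ y * ι
  ^-fixes-quotient e {x} {y} {ι} x*ι≈1 y*xᵉ≈x*yᵉ = begin
    (y * ι) ^ e             ≈⟨ ^-distrib-* y ι e ⟩
    y ^ e * ι ^ e           ≈⟨ *-identityʳ _ ⟨
    y ^ e * ι ^ e * 1#      ≈⟨ *-congˡ x*ι≈1 ⟨
    y ^ e * ι ^ e * (x * ι) ≈⟨ solve 4 (λ yᵉ ιᵉ x ι → (yᵉ :* ιᵉ :* (x :* ι)) := (x :* yᵉ :* (ι :* ιᵉ)))
                                       refl (y ^ e) (ι ^ e) x ι ⟩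
    x * y ^ e * (ι * ι ^ e) ≈⟨ *-congʳ y*xᵉ≈x*yᵉ ⟨
    y * x ^ e * (ι * ι ^ e) ≈⟨ solve 4 (λ y xᵉ ι ιᵉ → (y :* xᵉ :* (ι :* ιᵉ)) := (y :* ι :* (xᵉ :* ιᵉ)))
                                       refl y (x ^ e) ι (ι ^ e) ⟩
    y * ι * (x ^ e * ι ^ e) ≈⟨ *-congˡ (^-distrib-* x ι e) ⟨
    y * ι * (x * ι) ^ e     ≈⟨ *-congˡ (trans (^-congˡ e x*ι≈1) (1^n≈1 e)) ⟩
    y * ι * 1#              ≈⟨ *-identityʳ _ ⟩
    y * ι                   ∎

  conjugate-quotient-norm : ∀ q {x ι} → x * ι ≈ 1# → (x ^ q) ^ q ≈ x → (x ^ q * ι) ^ q * (x ^ q * ι) ≈ 1#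
  conjugate-quotient-norm q {x} {ι} x*ι≈1 x^q^q≈x = begin
    (y * ι) ^ q * (y * ι)   ≈⟨ *-congʳ (^-distrib-* y ι q) ⟩
    y ^ q * ι ^ q * (y * ι) ≈⟨ *-congʳ (*-congʳ x^q^q≈x) ⟩
    x * ι ^ q * (y * ι)     ≈⟨ solve 4 (λ x ιq y ι → (x :* ιq :* (y :* ι)) := ((x :* ι) :* (y :* ιq)))
                                       refl x (ι ^ q) y ι ⟩
    (x * ι) * (y * ι ^ q)   ≈⟨ *-congˡ (^-distrib-* x ι q) ⟨
    (x * ι) * (x * ι) ^ q   ≈⟨ *-cong x*ι≈1 (trans (^-congˡ q x*ι≈1) (1^n≈1 q)) ⟩
    1# * 1#                 ≈⟨ *-identityʳ 1# ⟩
    1#                      ∎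
    where
    y = x ^ q

  ×1-homo-^ : ∀ p n → (p ℕ.^ n) × 1# ≈ (p × 1#) ^ n
  ×1-homo-^ p zero    = +-identityʳ 1#
  ×1-homo-^ p (suc n) = trans (×1-homo-* p (p ℕ.^ n)) (*-congˡ (×1-homo-^ p n))

  odd-char⇒2≉0 : ∀ p → 1# ≉ 0# → p × 1# ≈ 0# → p ℕ.% 2 ≡ 1 → 1# + 1# ≉ 0#
  odd-char⇒2≉0 p 1≉0 p≈0 p-odd 2≈0 = 1≉0 (begin
    1#                  ≈⟨ +-identityʳ 1# ⟨
    1# + 0#             ≈⟨ +-congˡ 2h≈0 ⟨
    1# + (h ℕ.* 2) × 1# ≡⟨ ≡.cong (_× 1#) (odd⇒≡1+[n/2]*2 p p-odd) ⟨
    p × 1#              ≈⟨ p≈0 ⟩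
    0#                  ∎)
    where
    h = p ℕ./ 2
    2h≈0 : (h ℕ.* 2) × 1# ≈ 0#
    2h≈0 = trans (×1-homo-* h 2) (trans (*-congˡ (trans (+-congˡ (+-identityʳ 1#)) 2≈0)) (zeroʳ _))

  record Additive (e : ℕ) : Set (c Level.⊔ ℓ) where
    field
      ^-distrib-+ : ∀ x y → (x + y) ^ e ≈ x ^ e + y ^ e
  open Additive public

  module _ {e : ℕ} (e-additive : Additive e) where
    additive⇒0^e≈0 : 0# ^ e ≈ 0#
    additive⇒0^e≈0 = x+x≈x⇒x≈0 _ (trans (sym (^-distrib-+ e-additive 0# 0#)) (^-congˡ e (+-identityˡ 0#)))

    additive⇒[-x]^e≈-x^e : ∀ x → (- x) ^ e ≈ - (x ^ e)
    additive⇒[-x]^e≈-x^e x = +-inverseˡ-unique _ _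
      (trans (sym (^-distrib-+ e-additive (- x) x)) (trans (^-congˡ e (-‿inverseˡ x)) additive⇒0^e≈0))

    additive⇒[x-y]^e≈x^e-y^e : ∀ x y → (x - y) ^ e ≈ x ^ e - y ^ e
    additive⇒[x-y]^e≈x^e-y^e x y = trans (^-distrib-+ e-additive x (- y)) (+-congˡ (additive⇒[-x]^e≈-x^e y))

  additive-1 : Additive 1
  additive-1 .^-distrib-+ x y = trans (*-identityʳ _) (sym (+-cong (*-identityʳ x) (*-identityʳ y)))

  additive-* : ∀ {m n} → Additive m → Additive n → Additive (m ℕ.* n)
  additive-* {m} {n} m-additive n-additive .^-distrib-+ x y = begin
    (x + y) ^ (m ℕ.* n)           ≈⟨ ^-assocʳ (x + y) m n ⟨
    ((x + y) ^ m) ^ n             ≈⟨ ^-congˡ n (^-distrib-+ m-additive x y) ⟩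
    (x ^ m + y ^ m) ^ n           ≈⟨ ^-distrib-+ n-additive _ _ ⟩
    (x ^ m) ^ n + (y ^ m) ^ n     ≈⟨ +-cong (^-assocʳ x m n) (^-assocʳ y m n) ⟩
    x ^ (m ℕ.* n) + y ^ (m ℕ.* n) ∎

  additive-^ : ∀ {m} → Additive m → ∀ j → Additive (m ℕ.^ j)
  additive-^ m-additive zero    = additive-1
  additive-^ m-additive (suc j) = additive-* m-additive (additive-^ m-additive j)

  multiple-of-char : ∀ {p m} → p × 1# ≈ 0# → p ∣ m → ∀ z → m × z ≈ 0#
  multiple-of-char {p} p≈0 (divides d ≡.refl) z = begin
    (d ℕ.* p) × z             ≈⟨ ×-congʳ (d ℕ.* p) (*-identityˡ z) ⟨
    (d ℕ.* p) × (1# * z)      ≈⟨ ×-assoc-* (d ℕ.* p) 1# z ⟨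
    ((d ℕ.* p) × 1#) * z      ≈⟨ *-congʳ (×1-homo-* d p) ⟩
    ((d × 1#) * (p × 1#)) * z ≈⟨ *-congʳ (trans (*-congˡ p≈0) (zeroʳ _)) ⟩
    0# * z                    ≈⟨ zeroˡ z ⟩
    0#                        ∎

  frobenius : ∀ {p} → Prime p → p × 1# ≈ 0# → Additive p
  frobenius {zero}  p-prime _   = contradiction p-prime ¬prime[0]
  frobenius {suc n} p-prime p≈0 .^-distrib-+ x y = begin
    (x + y) ^ suc n               ≈⟨ theorem (suc n) x y ⟩
    binomialExpansion x y (suc n) ≈⟨ +-congˡ (sum-init-last (term ∘ Fin.suc)) ⟩
    term Fin.zero + (sum (term ∘ Fin.suc ∘ Fin.inject₁) + term (Fin.suc (Fin.fromℕ n)))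
      ≈⟨ +-cong first (+-cong (trans (sum-cong-≋ middle) (sum-replicate-zero n)) last) ⟩
    y ^ suc n + (0# + x ^ suc n)  ≈⟨ +-congˡ (+-identityˡ _) ⟩
    y ^ suc n + x ^ suc n         ≈⟨ +-comm _ _ ⟩
    x ^ suc n + y ^ suc n         ∎
    where
    term = binomialTerm x y (suc n)
    first : term Fin.zero ≈ y ^ suc n
    first = trans (×-homo-1 _) (*-identityˡ _)
    middle : ∀ j → term (Fin.suc (Fin.inject₁ j)) ≈ 0#
    middle j = multiple-of-char p≈0 (prime∣pCk p-prime (ℕ.s≤s ℕ.z≤n) (ℕ.s≤s j<n)) _
      where
      j<n : Fin.toℕ (Fin.inject₁ j) ℕ.< n
      j<n = ≡.subst (ℕ._< n) (≡.sym (toℕ-inject₁ j)) (toℕ<n j)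
    last : term (Fin.suc (Fin.fromℕ n)) ≈ x ^ suc n
    last rewrite toℕ-fromℕ n | nCn≡1 (suc n) | ℕ.n∸n≡0 n = trans (×-homo-1 _) (*-identityʳ _)

  -- With X₁, X₂, Y₁, Y₂ standing for X^r, X^{r²}, Y^r, Y^{r²}: the defect of this
  -- polynomial identity is X₁ times the difference of the two sides of ψ-cross.
  cross-multiplied : ∀ X X₁ X₂ Y Y₁ Y₂ →
    (X₂ + X₁) * (X₁ + X) * (Y * Y₂) ≈ (Y₂ + Y₁) * (Y₁ + Y) * (X * X₂) →
    X₁ * X₂ * (Y₂ + Y₁) * (Y * X₁ - X * Y₁)
    ≈ X * X₁ * (Y₁ + Y) * (Y₁ * X₂ - X₁ * Y₂) + X₁ * (Y * X₁ - X * Y₁) * (Y₁ * X₂ - X₁ * Y₂)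
  cross-multiplied X X₁ X₂ Y Y₁ Y₂ cross = begin
    X₁ * X₂ * (Y₂ + Y₁) * D
      ≈⟨ identity X X₁ X₂ Y Y₁ Y₂ ⟩
    X * X₁ * (Y₁ + Y) * Dʳ + X₁ * D * Dʳ
      + X₁ * ((X₂ + X₁) * (X₁ + X) * (Y * Y₂) - (Y₂ + Y₁) * (Y₁ + Y) * (X * X₂))
      ≈⟨ +-congˡ (*-congˡ (x≈y⇒x∙y⁻¹≈ε cross)) ⟩
    X * X₁ * (Y₁ + Y) * Dʳ + X₁ * D * Dʳ + X₁ * 0#
      ≈⟨ trans (+-congˡ (zeroʳ X₁)) (+-identityʳ _) ⟩
    X * X₁ * (Y₁ + Y) * Dʳ + X₁ * D * Dʳ ∎
    where
    D = Y * X₁ - X * Y₁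
    Dʳ = Y₁ * X₂ - X₁ * Y₂
    identity : ∀ X X₁ X₂ Y Y₁ Y₂ →
      X₁ * X₂ * (Y₂ + Y₁) * (Y * X₁ - X * Y₁)
      ≈ X * X₁ * (Y₁ + Y) * (Y₁ * X₂ - X₁ * Y₂) + X₁ * (Y * X₁ - X * Y₁) * (Y₁ * X₂ - X₁ * Y₂)
        + X₁ * ((X₂ + X₁) * (X₁ + X) * (Y * Y₂) - (Y₂ + Y₁) * (Y₁ + Y) * (X * X₂))
    identity = solve 6 (λ X X₁ X₂ Y Y₁ Y₂ →
      (X₁ :* X₂ :* (Y₂ :+ Y₁) :* (Y :* X₁ :- X :* Y₁))
      := (X :* X₁ :* (Y₁ :+ Y) :* (Y₁ :* X₂ :- X₁ :* Y₂)
          :+ X₁ :* (Y :* X₁ :- X :* Y₁) :* (Y₁ :* X₂ :- X₁ :* Y₂)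
          :+ X₁ :* ((X₂ :+ X₁) :* (X₁ :+ X) :* (Y :* Y₂) :- (Y₂ :+ Y₁) :* (Y₁ :+ Y) :* (X :* X₂)))) refl

  module Trace (r : ℕ) where
    Tr-cong : ∀ m {x y} → x ≈ y → Tr R r m x ≈ Tr R r m y
    Tr-cong zero    x≈y = refl
    Tr-cong (suc m) x≈y = +-cong (Tr-cong m x≈y) (^-congˡ (r ℕ.^ m) x≈y)

    Tr-^ : ∀ {e} → Additive e → ∀ m x → Tr R r m x ^ e ≈ Tr R r m (x ^ e)
    Tr-^ e-additive zero    x = additive⇒0^e≈0 e-additive
    Tr-^ {e} e-additive (suc m) x =
      trans (^-distrib-+ e-additive _ _) (+-cong (Tr-^ e-additive m x) (^-comm x (r ℕ.^ m) e))

    Tr-shift : ∀ m x → Tr R r m (x ^ r) + x ≈ Tr R r m x + x ^ (r ℕ.^ m)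
    Tr-shift zero    x = +-congˡ (sym (*-identityʳ x))
    Tr-shift (suc m) x = begin
      (Tr R r m (x ^ r) + (x ^ r) ^ (r ℕ.^ m)) + x     ≈⟨ +-congʳ (+-congˡ (^-assocʳ x r (r ℕ.^ m))) ⟩
      (Tr R r m (x ^ r) + x ^ (r ℕ.^ suc m)) + x       ≈⟨ xy∙z≈xz∙y _ _ _ ⟩
      (Tr R r m (x ^ r) + x) + x ^ (r ℕ.^ suc m)       ≈⟨ +-congʳ (Tr-shift m x) ⟩
      (Tr R r m x + x ^ (r ℕ.^ m)) + x ^ (r ℕ.^ suc m) ∎

    Tr-^r : ∀ m {x} → x ^ (r ℕ.^ m) ≈ x → Tr R r m (x ^ r) ≈ Tr R r m x
    Tr-^r m {x} x^r^m≈x =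
      +-cancelʳ x (Tr R r m (x ^ r)) (Tr R r m x) (trans (Tr-shift m x) (+-congˡ x^r^m≈x))

    module _ (r-additive : Additive r) where
      Tr-+ : ∀ m x y → Tr R r m (x + y) ≈ Tr R r m x + Tr R r m y
      Tr-+ zero    x y = sym (+-identityˡ 0#)
      Tr-+ (suc m) x y =
        trans (+-cong (Tr-+ m x y) (^-distrib-+ (additive-^ r-additive m) x y)) (interchange _ _ _ _)

      Tr-‿ : ∀ m x → Tr R r m (- x) ≈ - Tr R r m x
      Tr-‿ zero    x = sym -0#≈0#
      Tr-‿ (suc m) x =
        trans (+-cong (Tr-‿ m x) (additive⇒[-x]^e≈-x^e (additive-^ r-additive m) x)) (-‿+-comm _ _)

      Tr-fixed : ∀ m {x} → x ^ (r ℕ.^ m) ≈ x → Tr R r m x ^ r ≈ Tr R r m x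
      Tr-fixed m {x} x^r^m≈x = trans (Tr-^ r-additive m x) (Tr-^r m x^r^m≈x)

      Tr-artinSchreier : ∀ m {w} → w ^ (r ℕ.^ m) ≈ w → Tr R r m (w ^ r - w) ≈ 0#
      Tr-artinSchreier m {w} w^r^m≈w = begin
        Tr R r m (w ^ r - w)              ≈⟨ Tr-+ m (w ^ r) (- w) ⟩
        Tr R r m (w ^ r) + Tr R r m (- w) ≈⟨ +-cong (Tr-^r m w^r^m≈w) (Tr-‿ m w) ⟩
        Tr R r m w - Tr R r m w           ≈⟨ -‿inverseʳ _ ⟩
        0#                                ∎

  module Roots (r : ℕ) where
    IsRootOfψ : Carrier → Carrier → Set ℓ
    IsRootOfψ A z = A * A * (z * (z ^ r) ^ r) ≈ ((z ^ r) ^ r + z ^ r) * (z ^ r + z)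

    IsRootOfψ-^ : ∀ {e A z} → Additive e → A ^ e ≈ A → IsRootOfψ A z → IsRootOfψ A (z ^ e)
    IsRootOfψ-^ {e} {A} {z} e-additive A^e≈A z-root = begin
      A * A * (z ^ e * ((z ^ e) ^ r) ^ r)     ≈⟨ *-cong (*-cong A^e≈A A^e≈A) (*-congˡ z₂-comm) ⟨
      A ^ e * A ^ e * (z ^ e * z₂ ^ e)        ≈⟨ *-cong (^-distrib-* A A e) (^-distrib-* z z₂ e) ⟨
      (A * A) ^ e * (z * z₂) ^ e              ≈⟨ ^-distrib-* _ _ e ⟨
      (A * A * (z * z₂)) ^ e                  ≈⟨ ^-congˡ e z-root ⟩
      ((z₂ + z₁) * (z₁ + z)) ^ e              ≈⟨ ^-distrib-* _ _ e ⟩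
      (z₂ + z₁) ^ e * (z₁ + z) ^ e            ≈⟨ *-cong (^-distrib-+ e-additive _ _) (^-distrib-+ e-additive _ _) ⟩
      (z₂ ^ e + z₁ ^ e) * (z₁ ^ e + z ^ e)    ≈⟨ *-cong (+-cong z₂-comm z₁-comm) (+-congʳ z₁-comm) ⟩
      (((z ^ e) ^ r) ^ r + (z ^ e) ^ r) * ((z ^ e) ^ r + z ^ e) ∎
      where
      z₁ = z ^ r
      z₂ = z₁ ^ r
      z₁-comm : z₁ ^ e ≈ (z ^ e) ^ r
      z₁-comm = ^-comm z r e
      z₂-comm : z₂ ^ e ≈ ((z ^ e) ^ r) ^ r
      z₂-comm = trans (^-comm z₁ r e) (^-congˡ r z₁-comm)

    ψ-cross : ∀ {A X Y} → IsRootOfψ A X → IsRootOfψ A Y →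
              ((X ^ r) ^ r + X ^ r) * (X ^ r + X) * (Y * (Y ^ r) ^ r)
              ≈ ((Y ^ r) ^ r + Y ^ r) * (Y ^ r + Y) * (X * (X ^ r) ^ r)
    ψ-cross {A} {X} {Y} X-root Y-root = begin
      ((X ^ r) ^ r + X ^ r) * (X ^ r + X) * (Y * (Y ^ r) ^ r) ≈⟨ *-congʳ X-root ⟨
      A * A * (X * (X ^ r) ^ r) * (Y * (Y ^ r) ^ r)           ≈⟨ xy*z≈xz*y (A * A) _ _ ⟩
      A * A * (Y * (Y ^ r) ^ r) * (X * (X ^ r) ^ r)           ≈⟨ *-congʳ Y-root ⟩
      ((Y ^ r) ^ r + Y ^ r) * (Y ^ r + Y) * (X * (X ^ r) ^ r) ∎

    module _ (r-additive : Additive r) where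
      quotient-isRootOfψ : ∀ g → r ≡ suc (g ℕ.* 2) → ∀ {x y} →
                           x ^ ((r ℕ.* (r ℕ.∸ 1)) ℕ./ 2) * y ≈ 1# →
                           IsRootOfψ ((x ^ (r ℕ.∸ 1) + 1#) ^ ((r ℕ.+ 1) ℕ./ 2) * y) x
      quotient-isRootOfψ g ≡.refl {x} {y} b*y≈1 = begin
        (a * y) * (a * y) * (x * x₂)                ≈⟨ *-congˡ (*-congˡ (trans x₂≈x₁*Uʳ (*-congˡ (sym b*b≈Uʳ)))) ⟩
        (a * y) * (a * y) * (x * (x₁ * (b * b)))    ≈⟨ regroup a y x x₁ b ⟩
        a * a * (x * x₁) * ((b * y) * (b * y))      ≈⟨ *-cong (*-congʳ a*a≈[U+1][Uʳ+1]) (*-cong b*y≈1 b*y≈1) ⟩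
        (U + 1#) * (Uʳ + 1#) * (x * x₁) * (1# * 1#) ≈⟨ expand U Uʳ x x₁ ⟩
        (x₁ * Uʳ + x₁) * (x * U + x)                ≈⟨ *-congʳ (+-congʳ x₂≈x₁*Uʳ) ⟨
        (x₂ + x₁) * (x₁ + x)                        ∎
        where
        U = x ^ (g ℕ.* 2)
        Uʳ = U ^ r
        x₁ = x ^ r
        x₂ = x₁ ^ r
        a = (U + 1#) ^ ((r ℕ.+ 1) ℕ./ 2)
        b = x ^ ((r ℕ.* (g ℕ.* 2)) ℕ./ 2)
        x₂≈x₁*Uʳ : x₂ ≈ x₁ * Uʳ
        x₂≈x₁*Uʳ = ^-distrib-* x U r
        a*a≈[U+1][Uʳ+1] : a * a ≈ (U + 1#) * (Uʳ + 1#)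
        a*a≈[U+1][Uʳ+1] = begin
          a * a                    ≈⟨ *-congˡ (*-identityʳ a) ⟨
          a ^ 2                    ≈⟨ ^-congˡ 2 (^-congʳ (U + 1#) [r+1]/2≡1+g) ⟩
          ((U + 1#) ^ suc g) ^ 2   ≈⟨ ^-assocʳ (U + 1#) (suc g) 2 ⟩
          (U + 1#) * (U + 1#) ^ r  ≈⟨ *-congˡ (^-distrib-+ r-additive U 1#) ⟩
          (U + 1#) * (Uʳ + 1# ^ r) ≈⟨ *-congˡ (+-congˡ (1^n≈1 r)) ⟩
          (U + 1#) * (Uʳ + 1#)     ∎
          where
          [r+1]/2≡1+g : (r ℕ.+ 1) ℕ./ 2 ≡ suc g
          [r+1]/2≡1+g = ≡.trans (≡.cong (ℕ._/ 2) (ℕ.+-comm r 1)) (m*n/n≡m (suc g) 2)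
        b*b≈Uʳ : b * b ≈ Uʳ
        b*b≈Uʳ = begin
          b * b                    ≈⟨ *-congˡ (*-identityʳ b) ⟨
          b ^ 2                    ≈⟨ ^-congˡ 2 (^-congʳ x [r*2g]/2≡r*g) ⟩
          (x ^ (r ℕ.* g)) ^ 2      ≈⟨ ^-assocʳ x (r ℕ.* g) 2 ⟩
          x ^ (r ℕ.* g ℕ.* 2)      ≡⟨ ≡.cong (x ^_) (≡.trans (ℕ.*-assoc r g 2) (ℕ.*-comm r (g ℕ.* 2))) ⟩
          x ^ (g ℕ.* 2 ℕ.* r)      ≈⟨ ^-assocʳ x (g ℕ.* 2) r ⟨
          Uʳ                       ∎
          where
          [r*2g]/2≡r*g : (r ℕ.* (g ℕ.* 2)) ℕ./ 2 ≡ r ℕ.* g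
          [r*2g]/2≡r*g = ≡.trans (≡.cong (ℕ._/ 2) (≡.sym (ℕ.*-assoc r g 2))) (m*n/n≡m (r ℕ.* g) 2)
        regroup : ∀ a y x x₁ b →
                  (a * y) * (a * y) * (x * (x₁ * (b * b))) ≈ a * a * (x * x₁) * ((b * y) * (b * y))
        regroup = solve 5 (λ a y x x₁ b → ((a :* y) :* (a :* y) :* (x :* (x₁ :* (b :* b))))
                                         := (a :* a :* (x :* x₁) :* ((b :* y) :* (b :* y)))) refl
        expand : ∀ U Uʳ x x₁ → (U + 1#) * (Uʳ + 1#) * (x * x₁) * (1# * 1#) ≈ (x₁ * Uʳ + x₁) * (x * U + x)
        expand = solve 4 (λ U Uʳ x x₁ → ((U :+ con 1ℤ) :* (Uʳ :+ con 1ℤ) :* (x :* x₁) :* (con 1ℤ :* con 1ℤ))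
                                       := ((x₁ :* Uʳ :+ x₁) :* (x :* U :+ x))) refl

      artinSchreier-preimage : ∀ {A X Y d} → IsRootOfψ A X → IsRootOfψ A Y →
                               (Y * X ^ r - X * Y ^ r) * d ≈ 1# →
                               Σ Carrier (λ w → w ^ r - w ≈ X ^ r)
      artinSchreier-preimage {X = X} {Y} {d} X-root Y-root D*d≈1 =
        w , trans (+-congʳ wʳ≈w+X₁) (xyx⁻¹≈y w X₁)
        where
        X₁ = X ^ r
        X₂ = X₁ ^ r
        Y₁ = Y ^ r
        Y₂ = Y₁ ^ r
        D = Y * X₁ - X * Y₁
        Dʳ = Y₁ * X₂ - X₁ * Y₂
        w = X * X₁ * (Y₁ + Y) * d
        key = cross-multiplied X X₁ X₂ Y Y₁ Y₂ (ψ-cross X-root Y-root)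
        Dʳ*dʳ≈1 : Dʳ * d ^ r ≈ 1#
        Dʳ*dʳ≈1 = begin
          Dʳ * d ^ r    ≈⟨ *-congʳ D^r≈Dʳ ⟨
          D ^ r * d ^ r ≈⟨ ^-distrib-* D d r ⟨
          (D * d) ^ r   ≈⟨ ^-congˡ r D*d≈1 ⟩
          1# ^ r        ≈⟨ 1^n≈1 r ⟩
          1#            ∎
          where
          D^r≈Dʳ : D ^ r ≈ Dʳ
          D^r≈Dʳ = trans (additive⇒[x-y]^e≈x^e-y^e r-additive _ _)
                         (+-cong (^-distrib-* Y X₁ r) (-‿cong (^-distrib-* X Y₁ r)))
        wʳ≈w+X₁ : w ^ r ≈ w + X₁
        wʳ≈w+X₁ = begin
          w ^ r
            ≈⟨ wʳ≈ ⟩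
          X₁ * X₂ * (Y₂ + Y₁) * d ^ r
            ≈⟨ *-congʳ (trans (*-congˡ D*d≈1) (*-identityʳ _)) ⟨
          X₁ * X₂ * (Y₂ + Y₁) * (D * d) * d ^ r
            ≈⟨ *-congʳ (trans (sym (*-assoc _ _ _)) (*-congʳ key)) ⟩
          (X * X₁ * (Y₁ + Y) * Dʳ + X₁ * D * Dʳ) * d * d ^ r
            ≈⟨ distribute X X₁ (Y₁ + Y) D Dʳ d (d ^ r) ⟩
          w * (Dʳ * d ^ r) + X₁ * (D * d) * (Dʳ * d ^ r)
            ≈⟨ +-cong (*-congˡ Dʳ*dʳ≈1) (*-cong (*-congˡ D*d≈1) Dʳ*dʳ≈1) ⟩
          w * 1# + X₁ * 1# * 1#
            ≈⟨ +-cong (*-identityʳ w) (trans (*-identityʳ _) (*-identityʳ X₁)) ⟩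
          w + X₁ ∎
          where
          wʳ≈ : w ^ r ≈ X₁ * X₂ * (Y₂ + Y₁) * d ^ r
          wʳ≈ = trans (^-distrib-* _ d r) (*-congʳ (trans (^-distrib-* _ _ r)
                  (*-cong (^-distrib-* X X₁ r) (^-distrib-+ r-additive Y₁ Y))))
          distribute : ∀ X X₁ Z D Dʳ d dʳ → (X * X₁ * Z * Dʳ + X₁ * D * Dʳ) * d * dʳ
                                            ≈ X * X₁ * Z * d * (Dʳ * dʳ) + X₁ * (D * d) * (Dʳ * dʳ)
          distribute = solve 7 (λ X X₁ Z D Dʳ d dʳ → ((X :* X₁ :* Z :* Dʳ :+ X₁ :* D :* Dʳ) :* d :* dʳ)
                                 := (X :* X₁ :* Z :* d :* (Dʳ :* dʳ) :+ X₁ :* (D :* d) :* (Dʳ :* dʳ))) refl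

module FiniteField {c ℓ : Level} (F : CommutativeRing c ℓ) {N : ℕ}
                   (F-finite : IsFiniteFieldOfOrder F N) where
  open CommutativeRing F
  open IsFiniteFieldOfOrder F-finite
  open IntegerCoefficients F using (solve; _:+_; _:*_; _:-_; _:=_; con)
  open PowerMaps F using (×1-homo-^)
  open import Algebra.Properties.Ring ring
    using (+-identityˡ-unique; +-inverseˡ-unique; x≈y⇒x∙y⁻¹≈ε; x∙y⁻¹≈ε⇒x≈y)
  open import Algebra.Properties.Monoid +-monoid using () renaming (cancelˡ to +-cancel-inverseˡ)
  open import Algebra.Properties.Monoid *-monoid using () renaming (cancelˡ to *-cancel-inverseˡ)
  open import Algebra.Properties.Semiring.Exp semiring using (_^_; ^-congˡ)
  open import Algebra.Properties.Semiring.Mult semiring using (_×_)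
  open import Algebra.Properties.CommutativeMonoid.Sum +-commutativeMonoid using (sum)
  open import Algebra.Properties.CommutativeMonoid.Sum *-commutativeMonoid using () renaming (sum to product)
  open SumTranslation +-commutativeMonoid using () renaming (sum-translate to sum-translate⁺)
  open SumTranslation *-commutativeMonoid using () renaming (sum-translate to product-translate)
  open import Relation.Binary.Reasoning.Setoid setoid

  private
    module count = Inverse count

    enum : Fin N → Carrier
    enum = count.to

    index : Carrier → Fin N
    index = count.from

    enum-index : ∀ x → enum (index x) ≈ x
    enum-index x = count.inverseˡ ≡.refl

    index-enum : ∀ i → index (enum i) ≡ i
    index-enum i = count.inverseʳ refl

  infix 4 _≟_
  _≟_ : Decidable _≈_
  x ≟ y with index x Fin.≟ index y
  ... | yes ix≡iy = yes (begin
    x              ≈⟨ enum-index x ⟨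
    enum (index x) ≡⟨ ≡.cong enum ix≡iy ⟩
    enum (index y) ≈⟨ enum-index y ⟩
    y              ∎)
  ... | no ix≢iy = no (ix≢iy ∘ count.from-cong)

  *-cancelˡ : ∀ {x y z} → x ≉ 0# → x * y ≈ x * z → y ≈ z
  *-cancelˡ {x} {y} {z} x≉0 xy≈xz = begin
    y             ≈⟨ *-cancel-inverseˡ x⁻¹*x≈1 y ⟨
    x⁻¹ * (x * y) ≈⟨ *-congˡ xy≈xz ⟩
    x⁻¹ * (x * z) ≈⟨ *-cancel-inverseˡ x⁻¹*x≈1 z ⟩
    z             ∎
    where
    x⁻¹ = proj₁ (inverse x x≉0)
    x⁻¹*x≈1 = trans (*-comm x⁻¹ x) (proj₂ (inverse x x≉0))

  *-nonzero : ∀ {x y} → x ≉ 0# → y ≉ 0# → x * y ≉ 0#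
  *-nonzero {x} {y} x≉0 y≉0 xy≈0 = y≉0 (*-cancelˡ x≉0 (trans xy≈0 (sym (zeroʳ x))))

  ^-nonzero : ∀ {x} n → x ≉ 0# → x ^ n ≉ 0#
  ^-nonzero zero    x≉0 = 1≉0
  ^-nonzero (suc n) x≉0 = *-nonzero x≉0 (^-nonzero n x≉0)

  product-nonzero : ∀ {k} (t : Fin k → Carrier) → (∀ j → t j ≉ 0#) → product t ≉ 0#
  product-nonzero {zero}  t t≉0 = 1≉0
  product-nonzero {suc k} t t≉0 = *-nonzero (t≉0 Fin.zero) (product-nonzero (t ∘ Fin.suc) (t≉0 ∘ Fin.suc))

  private
    carrierPermutation : (f g : Carrier → Carrier) →
                         (∀ {x y} → x ≈ y → f x ≈ f y) → (∀ {x y} → x ≈ y → g x ≈ g y) →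
                         (∀ x → f (g x) ≈ x) → (∀ x → g (f x) ≈ x) → Permutation N N
    carrierPermutation f g f-cong g-cong f∘g≈id g∘f≈id = permutation
      (λ i → index (f (enum i))) (λ i → index (g (enum i)))
      (λ i → ≡.trans (count.from-cong (trans (f-cong (enum-index _)) (f∘g≈id _))) (index-enum i))
      (λ i → ≡.trans (count.from-cong (trans (g-cong (enum-index _)) (g∘f≈id _))) (index-enum i))

  -- Translation by 1 permutes the elements, so N·1 + Σ x = Σ x.
  characteristic : N × 1# ≈ 0#
  characteristic = +-identityˡ-unique (N × 1#) (sum enum)
    (sum-translate⁺ enum π 1# (λ i → sym (enum-index (1# + enum i))))
    where
    π : Permutation N N
    π = carrierPermutation (1# +_) (- 1# +_) +-congˡ +-congˡ
          (+-cancel-inverseˡ (-‿inverseʳ 1#)) (+-cancel-inverseˡ (-‿inverseˡ 1#))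

  private
    nonzero-order : ∀ {M} → Fin M → Σ ℕ (λ n → M ≡ suc n)
    nonzero-order {suc n} _ = n , ≡.refl

    -- The nonzero elements are enumerated by punching out the index of 0, and multiplication
    -- by a permutes them; so a^(N-1)·Π ≈ Π for their nonzero product Π.
    fermat-unit : ∀ {n} → N ≡ suc n → ∀ {a} → a ≉ 0# → a ^ n ≈ 1#
    fermat-unit {n} ≡.refl {a} a≉0 = *-cancelˡ (product-nonzero t t≉0) (begin
      product t * a ^ n ≈⟨ *-comm _ _ ⟩
      a ^ n * product t ≈⟨ product-translate t ρ a a*t≈t∘ρ ⟩
      product t         ≈⟨ *-identityʳ _ ⟨
      product t * 1#    ∎)
      where
      a⁻¹ = proj₁ (inverse a a≉0)
      a*a⁻¹≈1 = proj₂ (inverse a a≉0)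
      i₀ = index 0#
      t : Fin n → Carrier
      t j = enum (punchIn i₀ j)
      t≉0 : ∀ j → t j ≉ 0#
      t≉0 j tj≈0 = punchInᵢ≢i i₀ j (≡.trans (≡.sym (index-enum _)) (count.from-cong tj≈0))
      π : Permutation (suc n) (suc n)
      π = carrierPermutation (a *_) (a⁻¹ *_) *-congˡ *-congˡ
            (*-cancel-inverseˡ a*a⁻¹≈1) (*-cancel-inverseˡ (trans (*-comm a⁻¹ a) a*a⁻¹≈1))
      π-fixes-i₀ : π ⟨$⟩ʳ i₀ ≡ i₀
      π-fixes-i₀ = count.from-cong (trans (*-congˡ (enum-index 0#)) (zeroʳ a))
      ρ = Perm.remove i₀ π
      a*t≈t∘ρ : ∀ j → a * t j ≈ t (ρ ⟨$⟩ʳ j)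
      a*t≈t∘ρ j = begin
        a * t j                               ≈⟨ enum-index _ ⟨
        enum (π ⟨$⟩ʳ punchIn i₀ j)            ≡⟨ ≡.cong enum (Perm.punchIn-permute π i₀ j) ⟩
        enum (punchIn (π ⟨$⟩ʳ i₀) (ρ ⟨$⟩ʳ j)) ≡⟨ ≡.cong (λ i → enum (punchIn i (ρ ⟨$⟩ʳ j))) π-fixes-i₀ ⟩
        t (ρ ⟨$⟩ʳ j)                          ∎

    fermat-suc : ∀ {n} → N ≡ suc n → ∀ x → x ^ N ≈ x
    fermat-suc N≡1+n@≡.refl x with x ≟ 0#
    ... | yes x≈0 = trans (^-congˡ N x≈0) (trans (zeroˡ _) (sym x≈0))
    ... | no x≉0  = trans (*-congˡ (fermat-unit N≡1+n x≉0)) (*-identityʳ x)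

  fermat : ∀ x → x ^ N ≈ x
  fermat = fermat-suc (proj₂ (nonzero-order (index 0#)))

  ^≈0⇒≈0 : ∀ {x} n → x ^ n ≈ 0# → x ≈ 0#
  ^≈0⇒≈0 {x} n xⁿ≈0 with x ≟ 0#
  ... | yes x≈0 = x≈0
  ... | no x≉0  = contradiction xⁿ≈0 (^-nonzero n x≉0)

  order≡p^e⇒p×1≈0 : ∀ p e → N ≡ p ℕ.^ e → p × 1# ≈ 0#
  order≡p^e⇒p×1≈0 p e N≡p^e = ^≈0⇒≈0 e (begin
    (p × 1#) ^ e   ≈⟨ ×1-homo-^ p e ⟨
    (p ℕ.^ e) × 1# ≡⟨ ≡.cong (_× 1#) N≡p^e ⟨
    N × 1#         ≈⟨ characteristic ⟩
    0#             ∎)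

  x≈-x⇒x≈0 : 1# + 1# ≉ 0# → ∀ {x} → x ≈ - x → x ≈ 0#
  x≈-x⇒x≈0 2≉0 {x} x≈-x = *-cancelˡ 2≉0 (begin
    (1# + 1#) * x   ≈⟨ distribʳ x 1# 1# ⟩
    1# * x + 1# * x ≈⟨ +-cong (*-identityˡ x) (*-identityˡ x) ⟩
    x + x           ≈⟨ +-congˡ x≈-x ⟩
    x - x           ≈⟨ -‿inverseʳ x ⟩
    0#              ≈⟨ zeroʳ _ ⟨
    (1# + 1#) * 0#  ∎)

  x*x≈1⇒x≈-1 : ∀ {x} → x * x ≈ 1# → x ≉ 1# → x ≈ - 1#
  x*x≈1⇒x≈-1 {x} x*x≈1 x≉1 = +-inverseˡ-unique x 1# (*-cancelˡ x-1≉0 (begin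
    (x - 1#) * (x + 1#) ≈⟨ difference-of-squares x ⟩
    x * x - 1#          ≈⟨ x≈y⇒x∙y⁻¹≈ε x*x≈1 ⟩
    0#                  ≈⟨ zeroʳ _ ⟨
    (x - 1#) * 0#       ∎))
    where
    x-1≉0 : x - 1# ≉ 0#
    x-1≉0 = x≉1 ∘ x∙y⁻¹≈ε⇒x≈y x 1#
    difference-of-squares : ∀ x → (x - 1#) * (x + 1#) ≈ x * x - 1#
    difference-of-squares =
      solve 1 (λ x → ((x :- con 1ℤ) :* (x :+ con 1ℤ)) := (x :* x :- con 1ℤ)) refl

module QuadraticExtension {c ℓ : Level} (F : CommutativeRing c ℓ) (r m : ℕ)
                          (F-finite : IsFiniteFieldOfOrder F ((r ℕ.^ m) ℕ.^ 2)) where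
  open CommutativeRing F
  open IsFiniteFieldOfOrder F-finite using (inverse)
  open FiniteField F F-finite
  open PowerMaps F
  open Trace r
  open Roots r
  open import Algebra.Properties.Ring ring using (-1*x≈-x; x∙y⁻¹≈ε⇒x≈y)
  open import Algebra.Properties.Monoid *-monoid using () renaming (cancelʳ to *-cancel-inverseʳ)
  open import Algebra.Properties.Semiring.Exp semiring using (_^_; ^-congˡ; ^-congʳ; ^-assocʳ)
  open import Relation.Binary.Reasoning.Setoid setoid

  q : ℕ
  q = r ℕ.^ m

  fermat-q² : ∀ z → (z ^ q) ^ q ≈ z
  fermat-q² z =
    trans (^-assocʳ z q q) (trans (^-congʳ z (≡.cong (q ℕ.*_) (≡.sym (ℕ.*-identityʳ q)))) (fermat z))

  fermat-r^2m : ∀ z → z ^ (r ℕ.^ (2 ℕ.* m)) ≈ z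
  fermat-r^2m z =
    trans (^-congʳ z (≡.trans (≡.cong (r ℕ.^_) (ℕ.*-comm 2 m)) (≡.sym (ℕ.^-*-assoc r m 2)))) (fermat z)

  module _ (r-additive : Additive r) where
    q-additive : Additive q
    q-additive = additive-^ r-additive m

    x^q≈-x : ∀ {x} → x ≉ 0# → x ^ q ≉ x → x ^ q * x ^ r ≈ x * (x ^ q) ^ r → x ^ q ≈ - x
    x^q≈-x {x} x≉0 y≉x y*x₁≈x*y₁ = begin
      y        ≈⟨ y≈u*x ⟩
      u * x    ≈⟨ *-congʳ (x*x≈1⇒x≈-1 u*u≈1 u≉1) ⟩
      - 1# * x ≈⟨ -1*x≈-x x ⟩
      - x      ∎
      where
      y = x ^ q
      ι = proj₁ (inverse x x≉0)
      x*ι≈1 : x * ι ≈ 1#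
      x*ι≈1 = proj₂ (inverse x x≉0)
      u = y * ι
      y≈u*x : y ≈ u * x
      y≈u*x = sym (*-cancel-inverseʳ (trans (*-comm ι x) x*ι≈1) y)
      u≉1 : u ≉ 1#
      u≉1 u≈1 = y≉x (trans y≈u*x (trans (*-congʳ u≈1) (*-identityˡ x)))
      u*u≈1 : u * u ≈ 1#
      u*u≈1 = trans (*-congʳ (sym (^-fixed-^ (^-fixes-quotient r x*ι≈1 y*x₁≈x*y₁) m)))
                    (conjugate-quotient-norm q x*ι≈1 (fermat-q² x))

    trace-vanishes : 1# + 1# ≉ 0# → ∀ {A x} → ¬ InSubfield F q x → InSubfield F q A →
                     IsRootOfψ A x → Tr F r (2 ℕ.* m) x ≈ 0#
    trace-vanishes 2≉0 {x = x} x∉Fq A∈Fq x-root with x ^ q * x ^ r - x * (x ^ q) ^ r ≟ 0#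
    ... | no D≉0 = begin
      Tr F r (2 ℕ.* m) x           ≈⟨ Tr-^r (2 ℕ.* m) (fermat-r^2m x) ⟨
      Tr F r (2 ℕ.* m) (x ^ r)     ≈⟨ Tr-cong (2 ℕ.* m) w^r-w≈x^r ⟨
      Tr F r (2 ℕ.* m) (w ^ r - w) ≈⟨ Tr-artinSchreier r-additive (2 ℕ.* m) (fermat-r^2m w) ⟩
      0#                           ∎
      where
      x^q-root = IsRootOfψ-^ q-additive A∈Fq x-root
      preimage = artinSchreier-preimage r-additive x-root x^q-root (proj₂ (inverse _ D≉0))
      w = proj₁ preimage
      w^r-w≈x^r = proj₂ preimage
    ... | yes D≈0 = x≈-x⇒x≈0 2≉0 (begin
      Tr F r (2 ℕ.* m) x       ≈⟨ ^-fixed-^ (Tr-fixed r-additive (2 ℕ.* m) (fermat-r^2m x)) m ⟨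
      Tr F r (2 ℕ.* m) x ^ q   ≈⟨ Tr-^ q-additive (2 ℕ.* m) x ⟩
      Tr F r (2 ℕ.* m) (x ^ q) ≈⟨ Tr-cong (2 ℕ.* m) (x^q≈-x x≉0 x∉Fq (x∙y⁻¹≈ε⇒x≈y _ _ D≈0)) ⟩
      Tr F r (2 ℕ.* m) (- x)   ≈⟨ Tr-‿ r-additive (2 ℕ.* m) x ⟩
      - Tr F r (2 ℕ.* m) x     ∎)
      where
      x≉0 : x ≉ 0#
      x≉0 x≈0 = x∉Fq (trans (^-congˡ q x≈0) (trans (additive⇒0^e≈0 q-additive) (sym x≈0)))

open CommutativeRing using (Carrier; _≈_; _+_; 1#; 0#)

lemma5p2 : {c ℓ : Level} (p a k : ℕ) → Prime p → p ≢ 2 →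
    (F : CommutativeRing c ℓ) →
    IsFiniteFieldOfOrder F (((p ℕ.^ suc a) ℕ.^ suc k) ℕ.^ 2) →
    (x : Carrier F) →
    ¬ InSubfield F ((p ℕ.^ suc a) ℕ.^ suc k) x →
    QuotientInSubfield F ((p ℕ.^ suc a) ℕ.^ suc k)
      (pow F (_+_ F (pow F x ((p ℕ.^ suc a) ℕ.∸ 1)) (1# F)) (((p ℕ.^ suc a) ℕ.+ 1) ℕ./ 2))
      (pow F x (((p ℕ.^ suc a) ℕ.* ((p ℕ.^ suc a) ℕ.∸ 1)) ℕ./ 2)) →
    _≈_ F (Tr F (p ℕ.^ suc a) (2 ℕ.* suc k) x) (0# F)
lemma5p2 p a k p-prime p≢2 F F-finite x x∉Fq (y , b*y≈1 , A∈Fq) =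
  trace-vanishes r-additive 2≉0 x∉Fq A∈Fq (quotient-isRootOfψ r-additive (r ℕ./ 2) r-odd b*y≈1)
  where
  r = p ℕ.^ suc a
  open IsFiniteFieldOfOrder F-finite using (1≉0)
  open FiniteField F F-finite using (order≡p^e⇒p×1≈0)
  open PowerMaps F using (additive-^; frobenius; odd-char⇒2≉0)
  open PowerMaps.Roots F r using (quotient-isRootOfψ)
  open QuadraticExtension F r (suc k) F-finite using (trace-vanishes)
  p-odd = odd-prime p-prime p≢2
  r-odd = odd⇒≡1+[n/2]*2 r (odd-^ p p-odd (suc a))
  p×1≈0 = order≡p^e⇒p×1≈0 p (suc a ℕ.* suc k ℕ.* 2)
    (≡.trans (≡.cong (ℕ._^ 2) (ℕ.^-*-assoc p (suc a) (suc k))) (ℕ.^-*-assoc p (suc a ℕ.* suc k) 2))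
  r-additive = additive-^ (frobenius p-prime p×1≈0) (suc a)
  2≉0 = odd-char⇒2≉0 p 1≉0 p×1≈0 p-odd
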